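{- Let $n$ be an integer divisible by $3$ and let $G$ be a $3$-partite graph on $n$ vertices. Then there exists a partition $V(G)=A_1\cup A_2\cup A_3$ with $|A_1|=|A_2|=|A_3|=n/3$ such that $e(A_1)+e(A_2)+e(A_3)\leq \frac{4}{81}n^2$.
   Context: A graph is $3$-partite if its vertex set can be partitioned into three independent sets. For $S\subseteq V(G)$, $e(S)$ denotes the number of edges of $G$ with both endpoints in $S$. -}

module Defs where

open import Data.Nat using (ℕ; _+_; _<ᵇ_)
open import Data.Bool using (Bool; true; false; _∧_; if_then_else_)
open import Data.Fin using (Fin; toℕ)
open import Data.Fin.Properties using (_≟_)
open import Data.List using (List; filter; length; map; allFin)
open import Data.Nat.ListAction using (sum)
open import Data.Product using (Σ)
open import Data.Empty using (⊥)
import Data.Bool.Properties as BoolP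
open import Relation.Nullary.Decidable using (⌊_⌋)
open import Relation.Binary.PropositionalEquality using (_≡_)

record Graph (n : ℕ) : Set where
  field
    adj   : Fin n → Fin n → Bool
    sym   : ∀ i j → adj i j ≡ adj j i
    irref : ∀ i → adj i i ≡ false
open Graph public

Is3Partite : {n : ℕ} → Graph n → Set
Is3Partite {n} G =
  Σ (Fin n → Fin 3) (λ c → ∀ i j → adj G i j ≡ true → c i ≡ c j → ⊥)

card : {n : ℕ} → (Fin n → Bool) → ℕ
card {n} S = length (filter (λ i → S i BoolP.≟ true) (allFin n))

-- e(S): number of edges with both endpoints in S, counted over ordered
-- pairs (i , j) with toℕ i < toℕ j, i.e. each edge exactly once.
e : {n : ℕ} → Graph n → (Fin n → Bool) → ℕ
e {n} G S =
  sum (map (λ i → sum (map (λ j →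
         if (toℕ i <ᵇ toℕ j) ∧ S i ∧ S j ∧ adj G i j then 1 else 0)
       (allFin n))) (allFin n))

part : {n : ℕ} → (Fin n → Fin 3) → Fin 3 → Fin n → Bool
part c k i = ⌊ c i ≟ k ⌋

-- Write V_γ for the colour classes and y k γ = |A_k ∩ V_γ|. Every edge inside A_k joins two
-- different classes, so 2 e(A_k) ≤ |A_k|² − Σ_γ (y k γ)². It therefore suffices to find a
-- 3 × 3 matrix of naturals with row sums m = n/3, column sums |V_γ| and 9 Σ y² ≥ 19 m², since
-- every such matrix is the profile of a partition. With the classes sorted by size, the
-- largest one fills a whole row (m, 0, 0); a second whole row comes from another class of
-- size ≥ m or from the largest one again, and otherwise the smallest remaining amount is
-- split between the last two rows.

module Submission where

open import Defs hiding (sym)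
open import Data.Nat using (ℕ; zero; suc; _+_; _*_; _≤_; _<ᵇ_; z≤n; _≤?_)
open import Data.Fin using (Fin; zero; suc; toℕ)
open import Data.Product using (Σ; _×_; _,_; ∃-syntax; proj₁; proj₂)
open import Relation.Binary.PropositionalEquality

open import Data.Nat.Properties hiding (_≟_)
open import Algebra.Properties.Semiring.Sum +-*-semiring
  using (sum; sum-syntax; sum-cong-≗; sum-replicate-zero; ∑-distrib-+; ∑-comm;
         ∑-permute; *-distribˡ-sum; *-distribʳ-sum)
open import Data.Bool using (Bool; true; false; _∧_; if_then_else_; T)
import Data.Bool.Properties as Bool
open import Data.Empty using (⊥; ⊥-elim)
open import Data.Fin.Patterns using (0F; 1F; 2F)
open import Data.Fin.Permutation
  using (Permutation′; _⟨$⟩ʳ_; _⟨$⟩ˡ_; flip; inverseʳ; transpose; _∘ₚ_)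
  renaming (id to idₚ)
open import Data.Fin.Properties using (_≟_)
open import Data.List using ([]; _∷_; map; filter; length; tabulate; allFin)
import Data.Nat.ListAction as List
open import Data.Nat.Tactic.RingSolver using (solve-∀; solve)
open import Data.Sum using (inj₁; inj₂)
open import Data.Unit using (tt)
open import Function using (_∘_; id)
open import Relation.Nullary using (yes; no)
open import Relation.Nullary.Decidable using (⌊_⌋; ⌊⌋-map′; isYes≗does; dec-true)

∑∑-* : ∀ {m n} (f : Fin m → ℕ) (g : Fin n → ℕ) →
       ∑[ i < m ] ∑[ j < n ] (f i * g j) ≡ sum f * sum g
∑∑-* f g = trans (sum-cong-≗ (λ i → sym (*-distribˡ-sum (f i) g)))
                 (sym (*-distribʳ-sum (sum g) f))

∑∑-distrib-+ : ∀ {m n} (f g : Fin m → Fin n → ℕ) →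
               ∑[ i < m ] ∑[ j < n ] (f i j + g i j) ≡
               ∑[ i < m ] ∑[ j < n ] f i j + ∑[ i < m ] ∑[ j < n ] g i j
∑∑-distrib-+ f g = trans (sum-cong-≗ (λ i → ∑-distrib-+ (f i) (g i)))
                          (∑-distrib-+ (λ i → sum (f i)) (λ i → sum (g i)))

∑-mono-≤ : ∀ {n} {f g : Fin n → ℕ} → (∀ i → f i ≤ g i) → sum f ≤ sum g
∑-mono-≤ {zero}  f≤g = z≤n
∑-mono-≤ {suc n} f≤g = +-mono-≤ (f≤g zero) (∑-mono-≤ (f≤g ∘ suc))

sum≡0⇒≡0 : ∀ {n} (f : Fin n → ℕ) → sum f ≡ 0 → ∀ i → f i ≡ 0
sum≡0⇒≡0 f eq zero    = m+n≡0⇒m≡0 (f zero) eq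
sum≡0⇒≡0 f eq (suc i) = sum≡0⇒≡0 (f ∘ suc) (m+n≡0⇒n≡0 (f zero) eq) i

∑₃ : (f : Fin 3 → ℕ) → ∑[ i < 3 ] f i ≡ f 0F + f 1F + f 2F
∑₃ f = regroup (f 0F) (f 1F) (f 2F)
  where
  regroup : ∀ a b c → a + (b + (c + 0)) ≡ a + b + c
  regroup = solve-∀

⟦_⟧ : Bool → ℕ
⟦ b ⟧ = if b then 1 else 0

⟦∧⟧ : ∀ a b → ⟦ a ∧ b ⟧ ≡ ⟦ a ⟧ * ⟦ b ⟧
⟦∧⟧ true  b = sym (+-identityʳ ⟦ b ⟧)
⟦∧⟧ false b = refl

⌊≟-refl⌋ : ∀ {r} (c : Fin r) → ⌊ c ≟ c ⌋ ≡ true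
⌊≟-refl⌋ c = trans (isYes≗does (c ≟ c)) (dec-true (c ≟ c) refl)

⌊suc≟suc⌋ : ∀ {r} (c γ : Fin r) → ⌊ suc c ≟ suc γ ⌋ ≡ ⌊ c ≟ γ ⌋
⌊suc≟suc⌋ c γ = ⌊⌋-map′ _ _ (c ≟ γ)

∑-δ : ∀ {r} (c : Fin r) (f : Fin r → ℕ) → ∑[ γ < r ] (⟦ ⌊ c ≟ γ ⌋ ⟧ * f γ) ≡ f c
∑-δ {suc r} zero f =
  trans (cong₂ _+_ (*-identityˡ (f zero)) (sum-replicate-zero r)) (+-identityʳ (f zero))
∑-δ {suc r} (suc c) f =
  trans (sum-cong-≗ (λ γ → cong (λ b → ⟦ b ⟧ * f (suc γ)) (⌊suc≟suc⌋ c γ)))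
        (∑-δ c (f ∘ suc))

count : ∀ {n} → (Fin n → Bool) → ℕ
count {n} P = ∑[ i < n ] ⟦ P i ⟧

count-true : ∀ n → count {n} (λ _ → true) ≡ n
count-true zero    = refl
count-true (suc n) = cong suc (count-true n)

sum-map-tabulate : ∀ {n} {A : Set} (g : A → ℕ) (h : Fin n → A) →
                   List.sum (map g (tabulate h)) ≡ ∑[ i < n ] g (h i)
sum-map-tabulate {zero}  g h = refl
sum-map-tabulate {suc n} g h = cong (g (h zero) +_) (sum-map-tabulate g (h ∘ suc))

sum-map-allFin : ∀ {n} (g : Fin n → ℕ) → List.sum (map g (allFin n)) ≡ sum g
sum-map-allFin g = sum-map-tabulate g id

length-filter-tabulate : ∀ {n k} (P : Fin k → Bool) (h : Fin n → Fin k) →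
  length (filter (λ i → P i Bool.≟ true) (tabulate h)) ≡ ∑[ i < n ] ⟦ P (h i) ⟧
length-filter-tabulate {zero}  P h = refl
length-filter-tabulate {suc n} P h with P (h zero)
... | true  = cong suc (length-filter-tabulate P (h ∘ suc))
... | false = length-filter-tabulate P (h ∘ suc)

card≡count : ∀ {n} (P : Fin n → Bool) → card P ≡ count P
card≡count P = length-filter-tabulate P id

e≡∑∑ : ∀ {n} (G : Graph n) (P : Fin n → Bool) →
       e G P ≡ ∑[ i < n ] ∑[ j < n ] ⟦ (toℕ i <ᵇ toℕ j) ∧ P i ∧ P j ∧ adj G i j ⟧
e≡∑∑ {n} G P = trans (sum-map-allFin (λ i → List.sum (map (λ j → ⟦ pair i j ⟧) (allFin n))))
                      (sum-cong-≗ (λ i → sum-map-allFin (λ j → ⟦ pair i j ⟧)))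
  where
  pair : Fin n → Fin n → Bool
  pair i j = (toℕ i <ᵇ toℕ j) ∧ P i ∧ P j ∧ adj G i j

-- Colour classes

classSize : ∀ {n r} → (Fin n → Fin r) → (Fin n → Bool) → Fin r → ℕ
classSize κ P γ = count (λ i → P i ∧ ⌊ κ i ≟ γ ⌋)

module _ {n r} (κ : Fin n → Fin r) (P : Fin n → Bool) where

  count≡∑classSize : count P ≡ ∑[ γ < r ] classSize κ P γ
  count≡∑classSize = begin
    count P
      ≡⟨ sum-cong-≗ (λ i → sym (∑-δ (κ i) (λ _ → ⟦ P i ⟧))) ⟩
    ∑[ i < n ] ∑[ γ < r ] (⟦ ⌊ κ i ≟ γ ⌋ ⟧ * ⟦ P i ⟧)
      ≡⟨ sum-cong-≗ (λ i → sum-cong-≗ (λ γ →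
           trans (*-comm ⟦ ⌊ κ i ≟ γ ⌋ ⟧ ⟦ P i ⟧) (sym (⟦∧⟧ (P i) ⌊ κ i ≟ γ ⌋)))) ⟩
    ∑[ i < n ] ∑[ γ < r ] ⟦ P i ∧ ⌊ κ i ≟ γ ⌋ ⟧
      ≡⟨ ∑-comm (λ i γ → ⟦ P i ∧ ⌊ κ i ≟ γ ⌋ ⟧) ⟩
    ∑[ γ < r ] classSize κ P γ ∎
    where open ≡-Reasoning

  same-colour-pairs :
    ∑[ i < n ] ∑[ j < n ] (⟦ P i ⟧ * ⟦ P j ∧ ⌊ κ j ≟ κ i ⌋ ⟧) ≡
    ∑[ γ < r ] (classSize κ P γ * classSize κ P γ)
  same-colour-pairs = begin
    ∑[ i < n ] ∑[ j < n ] (⟦ P i ⟧ * x j (κ i))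
      ≡⟨ sum-cong-≗ (λ i → sum-cong-≗ (λ j → sym (∑-same-colour i j))) ⟩
    ∑[ i < n ] ∑[ j < n ] ∑[ γ < r ] (x i γ * x j γ)
      ≡⟨ sum-cong-≗ (λ i → ∑-comm (λ j γ → x i γ * x j γ)) ⟩
    ∑[ i < n ] ∑[ γ < r ] ∑[ j < n ] (x i γ * x j γ)
      ≡⟨ ∑-comm (λ i γ → ∑[ j < n ] (x i γ * x j γ)) ⟩
    ∑[ γ < r ] ∑[ i < n ] ∑[ j < n ] (x i γ * x j γ)
      ≡⟨ sum-cong-≗ (λ γ → ∑∑-* (λ i → x i γ) (λ j → x j γ)) ⟩
    ∑[ γ < r ] (classSize κ P γ * classSize κ P γ) ∎
    where
    open ≡-Reasoning
    x : Fin n → Fin r → ℕ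
    x i γ = ⟦ P i ∧ ⌊ κ i ≟ γ ⌋ ⟧

    ∑-same-colour : ∀ i j → ∑[ γ < r ] (x i γ * x j γ) ≡ ⟦ P i ⟧ * x j (κ i)
    ∑-same-colour i j =
      trans (sum-cong-≗ (λ γ → trans (cong (_* x j γ) (⟦∧⟧ (P i) ⌊ κ i ≟ γ ⌋))
                                     (reorder ⟦ P i ⟧ ⟦ ⌊ κ i ≟ γ ⌋ ⟧ (x j γ))))
            (∑-δ (κ i) (λ γ → ⟦ P i ⟧ * x j γ))
      where
      reorder : ∀ p d y → p * d * y ≡ d * (p * y)
      reorder = solve-∀

∑classSize≡n : ∀ {n r} (κ : Fin n → Fin r) → ∑[ γ < r ] classSize κ (λ _ → true) γ ≡ n
∑classSize≡n {n} κ = trans (sym (count≡∑classSize κ (λ _ → true))) (count-true n)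

-- Edges inside a set

IsProperColouring : ∀ {n r} → Graph n → (Fin n → Fin r) → Set
IsProperColouring G κ = ∀ i j → adj G i j ≡ true → κ i ≡ κ j → ⊥

⟦<ᵇ∧⟧+⟦>ᵇ∧⟧≤⟦⟧ : ∀ x y b → ⟦ (x <ᵇ y) ∧ b ⟧ + ⟦ (y <ᵇ x) ∧ b ⟧ ≤ ⟦ b ⟧
⟦<ᵇ∧⟧+⟦>ᵇ∧⟧≤⟦⟧ x y b with x <ᵇ y in x<y | y <ᵇ x in y<x
... | true  | true  = ⊥-elim (<-asym (<ᵇ⇒< x y (subst T (sym x<y) tt))
                                     (<ᵇ⇒< y x (subst T (sym y<x) tt)))
... | true  | false = ≤-reflexive (+-identityʳ ⟦ b ⟧)
... | false | true  = ≤-refl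
... | false | false = z≤n

module _ {n} (G : Graph n) (P : Fin n → Bool) where

  edge : Fin n → Fin n → Bool
  edge i j = P i ∧ P j ∧ adj G i j

  edge-sym : ∀ i j → edge i j ≡ edge j i
  edge-sym i j with P i | P j
  ... | true  | true  = Graph.sym G i j
  ... | true  | false = refl
  ... | false | true  = refl
  ... | false | false = refl

  2*e≤∑∑edge : 2 * e G P ≤ ∑[ i < n ] ∑[ j < n ] ⟦ edge i j ⟧
  2*e≤∑∑edge = begin
    2 * e G P
      ≡⟨ cong (e G P +_) (+-identityʳ (e G P)) ⟩
    e G P + e G P
      ≡⟨ cong₂ _+_ (e≡∑∑ G P) e≡∑∑-reversed ⟩
    ∑[ i < n ] ∑[ j < n ] forward i j + ∑[ i < n ] ∑[ j < n ] backward i j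
      ≡⟨ ∑∑-distrib-+ forward backward ⟨
    ∑[ i < n ] ∑[ j < n ] (forward i j + backward i j)
      ≤⟨ ∑-mono-≤ (λ i → ∑-mono-≤ (λ j → ⟦<ᵇ∧⟧+⟦>ᵇ∧⟧≤⟦⟧ (toℕ i) (toℕ j) (edge i j))) ⟩
    ∑[ i < n ] ∑[ j < n ] ⟦ edge i j ⟧ ∎
    where
    open ≤-Reasoning
    forward backward : Fin n → Fin n → ℕ
    forward  i j = ⟦ (toℕ i <ᵇ toℕ j) ∧ edge i j ⟧
    backward i j = ⟦ (toℕ j <ᵇ toℕ i) ∧ edge i j ⟧

    e≡∑∑-reversed : e G P ≡ ∑[ i < n ] ∑[ j < n ] backward i j
    e≡∑∑-reversed =
      trans (e≡∑∑ G P)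
        (trans (sum-cong-≗ (λ i → sum-cong-≗ (λ j →
                  cong (λ b → ⟦ (toℕ i <ᵇ toℕ j) ∧ b ⟧) (edge-sym i j))))
               (∑-comm (λ i j → backward j i)))

module _ {n r} (G : Graph n) (κ : Fin n → Fin r) (proper : IsProperColouring G κ)
         (P : Fin n → Bool) where

  edge-or-same-colour : ∀ i j →
    ⟦ edge G P i j ⟧ + ⟦ P i ⟧ * ⟦ P j ∧ ⌊ κ j ≟ κ i ⌋ ⟧ ≤ ⟦ P i ⟧ * ⟦ P j ⟧
  edge-or-same-colour i j with P i | P j | adj G i j in ij | κ j ≟ κ i
  ... | false | _     | _     | _     = z≤n
  ... | true  | false | _     | _     = z≤n
  ... | true  | true  | true  | yes p = ⊥-elim (proper i j ij (sym p))
  ... | true  | true  | true  | no _  = ≤-refl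
  ... | true  | true  | false | yes _ = ≤-refl
  ... | true  | true  | false | no _  = z≤n

  edges-within : 2 * e G P + ∑[ γ < r ] (classSize κ P γ * classSize κ P γ) ≤ count P * count P
  edges-within = begin
    2 * e G P + ∑[ γ < r ] (classSize κ P γ * classSize κ P γ)
      ≡⟨ cong (2 * e G P +_) (same-colour-pairs κ P) ⟨
    2 * e G P + ∑[ i < n ] ∑[ j < n ] same-colour i j
      ≤⟨ +-monoˡ-≤ _ (2*e≤∑∑edge G P) ⟩
    ∑[ i < n ] ∑[ j < n ] ⟦ edge G P i j ⟧ + ∑[ i < n ] ∑[ j < n ] same-colour i j
      ≡⟨ ∑∑-distrib-+ (λ i j → ⟦ edge G P i j ⟧) same-colour ⟨
    ∑[ i < n ] ∑[ j < n ] (⟦ edge G P i j ⟧ + same-colour i j)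
      ≤⟨ ∑-mono-≤ (λ i → ∑-mono-≤ (edge-or-same-colour i)) ⟩
    ∑[ i < n ] ∑[ j < n ] (⟦ P i ⟧ * ⟦ P j ⟧)
      ≡⟨ ∑∑-* (⟦_⟧ ∘ P) (⟦_⟧ ∘ P) ⟩
    count P * count P ∎
    where
    open ≤-Reasoning
    same-colour : Fin n → Fin n → ℕ
    same-colour i j = ⟦ P i ⟧ * ⟦ P j ∧ ⌊ κ j ≟ κ i ⌋ ⟧

-- Partitions with a prescribed profile

profile : ∀ {n r s} → (Fin n → Fin r) → (Fin n → Fin s) → Fin s → Fin r → ℕ
profile κ σ k γ = classSize κ (λ i → ⌊ σ i ≟ k ⌋) γ

sum≡suc⇒δ+rest : ∀ {s} (t : Fin s → ℕ) {c} → sum t ≡ suc c →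
  ∃[ k ] ∃[ t′ ] (sum t′ ≡ c × (∀ j → t j ≡ ⟦ ⌊ k ≟ j ⌋ ⟧ + t′ j))
sum≡suc⇒δ+rest {suc s} t eq with t zero in t₀
... | suc z = zero , (λ { zero → z ; (suc j) → t (suc j) }) , suc-injective eq ,
              λ { zero → t₀ ; (suc j) → refl }
... | zero with sum≡suc⇒δ+rest (t ∘ suc) eq
...   | k , t′ , eq′ , t≡ = suc k , (λ { zero → 0 ; (suc j) → t′ j }) , eq′ ,
          λ { zero → t₀
            ; (suc j) → trans (t≡ j) (cong (λ b → ⟦ b ⟧ + t′ j) (sym (⌊suc≟suc⌋ k j))) }

profile-realisable : ∀ {n r s} (κ : Fin n → Fin r) (T : Fin s → Fin r → ℕ) →
  (∀ γ → ∑[ k < s ] T k γ ≡ classSize κ (λ _ → true) γ) →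
  ∃[ σ ] (∀ k γ → profile κ σ k γ ≡ T k γ)
profile-realisable {zero} κ T cols =
  (λ ()) , λ k γ → sym (sum≡0⇒≡0 (λ k → T k γ) (cols γ) k)
profile-realisable {suc n} {r} {s} κ T cols
  with sum≡suc⇒δ+rest (λ k → T k (κ zero))
         (trans (cols (κ zero))
                (cong (λ b → ⟦ b ⟧ + classSize (κ ∘ suc) (λ _ → true) (κ zero))
                      (⌊≟-refl⌋ (κ zero))))
... | k₀ , t′ , sum-t′ , T≡ = σ , σ-profile
  where
  T′ : Fin s → Fin r → ℕ
  T′ k γ = if ⌊ κ zero ≟ γ ⌋ then t′ k else T k γ

  cols′ : ∀ γ → ∑[ k < s ] T′ k γ ≡ classSize (κ ∘ suc) (λ _ → true) γ
  cols′ γ with κ zero ≟ γ | cols γ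
  ... | yes refl | _     = sum-t′
  ... | no _     | cols≡ = cols≡

  rest : ∃[ σ ] (∀ k γ → profile (κ ∘ suc) σ k γ ≡ T′ k γ)
  rest = profile-realisable (κ ∘ suc) T′ cols′

  σ : Fin (suc n) → Fin s
  σ zero    = k₀
  σ (suc i) = proj₁ rest i

  σ-profile : ∀ k γ → profile κ σ k γ ≡ T k γ
  σ-profile k γ with κ zero ≟ γ | proj₂ rest k γ
  ... | yes refl | p = trans (cong₂ _+_ (cong ⟦_⟧ (Bool.∧-identityʳ _)) p) (sym (T≡ k))
  ... | no _     | p = cong₂ _+_ (cong ⟦_⟧ (Bool.∧-zeroʳ _)) p

-- Concentrated 3 × 3 profiles

v3 : {A : Set} → A → A → A → Fin 3 → A
v3 a b c 0F = a
v3 a b c 1F = b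
v3 a b c 2F = c

Matrix : Set
Matrix = Fin 3 → Fin 3 → ℕ

squares : Matrix → ℕ
squares y = ∑[ k < 3 ] ∑[ γ < 3 ] (y k γ * y k γ)

-- 19/9 is what the count needs: then 2 Σ e(A_k) ≤ 3m² − Σ y² ≤ 8m²/9.
record Concentrated (m : ℕ) (N : Fin 3 → ℕ) (y : Matrix) : Set where
  field
    row-sum       : ∀ k → ∑[ γ < 3 ] y k γ ≡ m
    col-sum       : ∀ γ → ∑[ k < 3 ] y k γ ≡ N γ
    squares-bound : 19 * (m * m) ≤ 9 * squares y

concentrated₃ : ∀ {m n₀ n₁ n₂} x₀₀ x₀₁ x₀₂ x₁₀ x₁₁ x₁₂ x₂₀ x₂₁ x₂₂ →
  x₀₀ + x₀₁ + x₀₂ ≡ m → x₁₀ + x₁₁ + x₁₂ ≡ m → x₂₀ + x₂₁ + x₂₂ ≡ m →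
  x₀₀ + x₁₀ + x₂₀ ≡ n₀ → x₀₁ + x₁₁ + x₂₁ ≡ n₁ → x₀₂ + x₁₂ + x₂₂ ≡ n₂ →
  19 * (m * m) ≤ 9 * (x₀₀ * x₀₀ + x₀₁ * x₀₁ + x₀₂ * x₀₂ + (x₁₀ * x₁₀ + x₁₁ * x₁₁ + x₁₂ * x₁₂)
                      + (x₂₀ * x₂₀ + x₂₁ * x₂₁ + x₂₂ * x₂₂)) →
  Concentrated m (v3 n₀ n₁ n₂) (v3 (v3 x₀₀ x₀₁ x₀₂) (v3 x₁₀ x₁₁ x₁₂) (v3 x₂₀ x₂₁ x₂₂))
concentrated₃ {m} {n₀} {n₁} {n₂} x₀₀ x₀₁ x₀₂ x₁₀ x₁₁ x₁₂ x₂₀ x₂₁ x₂₂ r₀ r₁ r₂ c₀ c₁ c₂ bound = record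
  { row-sum       = λ k → trans (∑₃ (y k)) (rows k)
  ; col-sum       = λ γ → trans (∑₃ (λ k → y k γ)) (cols γ)
  ; squares-bound = subst (λ q → 19 * (m * m) ≤ 9 * q) (sym squares≡) bound
  }
  where
  y : Matrix
  y = v3 (v3 x₀₀ x₀₁ x₀₂) (v3 x₁₀ x₁₁ x₁₂) (v3 x₂₀ x₂₁ x₂₂)
  rows : ∀ k → y k 0F + y k 1F + y k 2F ≡ m
  rows = λ { 0F → r₀ ; 1F → r₁ ; 2F → r₂ }
  cols : ∀ γ → y 0F γ + y 1F γ + y 2F γ ≡ v3 n₀ n₁ n₂ γ
  cols = λ { 0F → c₀ ; 1F → c₁ ; 2F → c₂ }
  sq : Fin 3 → Fin 3 → ℕ
  sq k γ = y k γ * y k γ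
  squares≡ : squares y ≡ (sq 0F 0F + sq 0F 1F + sq 0F 2F) + (sq 1F 0F + sq 1F 1F + sq 1F 2F)
                         + (sq 2F 0F + sq 2F 1F + sq 2F 2F)
  squares≡ = trans (∑₃ (sum ∘ sq)) (cong₂ _+_ (cong₂ _+_ (∑₃ (sq 0F)) (∑₃ (sq 1F))) (∑₃ (sq 2F)))

concentrated-unpermute : ∀ {m N N′ y} (π : Permutation′ 3) →
  (∀ γ → N′ γ ≡ N (π ⟨$⟩ʳ γ)) → Concentrated m N′ y →
  Concentrated m N (λ k γ → y k (π ⟨$⟩ˡ γ))
concentrated-unpermute {m} {N} {y = y} π N′≡ c = record
  { row-sum       = λ k → trans (sym (∑-permute (y k) (flip π))) (row-sum k)
  ; col-sum       = λ γ → trans (col-sum (π ⟨$⟩ˡ γ))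
                                (trans (N′≡ (π ⟨$⟩ˡ γ)) (cong N (inverseʳ π)))
  ; squares-bound = subst (λ q → 19 * (m * m) ≤ 9 * q)
      (sum-cong-≗ (λ k → ∑-permute (λ γ → y k γ * y k γ) (flip π))) squares-bound
  }
  where open Concentrated c

sort₃ : (N : Fin 3 → ℕ) →
  Σ (Permutation′ 3) λ π → N (π ⟨$⟩ʳ 1F) ≤ N (π ⟨$⟩ʳ 0F) × N (π ⟨$⟩ʳ 2F) ≤ N (π ⟨$⟩ʳ 1F)
sort₃ N with ≤-total (N 1F) (N 0F) | ≤-total (N 2F) (N 1F) | ≤-total (N 2F) (N 0F)
... | inj₁ 1≤0 | inj₁ 2≤1 | _        = idₚ , 1≤0 , 2≤1
... | inj₁ 1≤0 | inj₂ 1≤2 | inj₁ 2≤0 = transpose 1F 2F , 2≤0 , 1≤2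
... | inj₁ 1≤0 | inj₂ 1≤2 | inj₂ 0≤2 = transpose 0F 1F ∘ₚ transpose 1F 2F , 0≤2 , 1≤0
... | inj₂ 0≤1 | inj₁ 2≤1 | inj₁ 2≤0 = transpose 0F 1F , 0≤1 , 2≤0
... | inj₂ 0≤1 | inj₁ 2≤1 | inj₂ 0≤2 = transpose 1F 2F ∘ₚ transpose 0F 1F , 2≤1 , 0≤2
... | inj₂ 0≤1 | inj₂ 1≤2 | _        = transpose 0F 2F , 1≤2 , 0≤1

2*m*[m+k]≤m²+[m+k]² : ∀ m k → 2 * m * (m + k) ≤ m * m + (m + k) * (m + k)
2*m*[m+k]≤m²+[m+k]² m k =
  subst (2 * m * (m + k) ≤_) (sym (square-gap m k)) (m≤m+n (2 * m * (m + k)) (k * k))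
  where
  square-gap : ∀ m k → m * m + (m + k) * (m + k) ≡ 2 * m * (m + k) + k * k
  square-gap = solve-∀

2*m*n≤m²+n² : ∀ m n → 2 * m * n ≤ m * m + n * n
2*m*n≤m²+n² m n with ≤-total m n
... | inj₁ m≤n with k , refl ← m≤n⇒∃[o]m+o≡n m≤n = 2*m*[m+k]≤m²+[m+k]² m k
... | inj₂ n≤m with k , refl ← m≤n⇒∃[o]m+o≡n n≤m =
  subst₂ _≤_ (swap n k) (+-comm (n * n) ((n + k) * (n + k))) (2*m*[m+k]≤m²+[m+k]² n k)
  where
  swap : ∀ n k → 2 * n * (n + k) ≡ 2 * (n + k) * n
  swap = solve-∀

[a+b+c]²≤3[a²+b²+c²] : ∀ a b c → (a + b + c) * (a + b + c) ≤ 3 * (a * a + b * b + c * c)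
[a+b+c]²≤3[a²+b²+c²] a b c = begin
  (a + b + c) * (a + b + c)
    ≡⟨ solve (a ∷ b ∷ c ∷ []) ⟩
  a * a + b * b + c * c + (2 * a * b + 2 * b * c + 2 * a * c)
    ≤⟨ +-monoʳ-≤ (a * a + b * b + c * c)
         (+-mono-≤ (+-mono-≤ (2*m*n≤m²+n² a b) (2*m*n≤m²+n² b c)) (2*m*n≤m²+n² a c)) ⟩
  a * a + b * b + c * c + (a * a + b * b + (b * b + c * c) + (a * a + c * c))
    ≡⟨ solve (a ∷ b ∷ c ∷ []) ⟩
  3 * (a * a + b * b + c * c) ∎
  where open ≤-Reasoning

two-full-rows-bound : ∀ {m} a b c → a + b + c ≡ m →
  19 * (m * m) ≤ 9 * (m * m + m * m + (a * a + b * b + c * c))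
two-full-rows-bound a b c refl = begin
  19 * (s * s)                         ≤⟨ *-monoˡ-≤ (s * s) (m≤m+n 19 2) ⟩
  21 * (s * s)                         ≡⟨ *-distribʳ-+ (s * s) 18 3 ⟩
  18 * (s * s) + 3 * (s * s)           ≤⟨ +-monoʳ-≤ (18 * (s * s))
                                            (*-monoʳ-≤ 3 ([a+b+c]²≤3[a²+b²+c²] a b c)) ⟩
  18 * (s * s) + 3 * (3 * q)           ≡⟨ regroup (s * s) q ⟩
  9 * (s * s + s * s + q)              ∎
  where
  open ≤-Reasoning
  s q : ℕ
  s = a + b + c
  q = a * a + b * b + c * c
  regroup : ∀ x q → 18 * x + 3 * (3 * q) ≡ 9 * (x + x + q)
  regroup = solve-∀

-- split-bound after doubling, with 2m = 3(a + b) + d, 2s = a + 3b + d and 2t = b + 3a + d;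
-- the two sides differ by 36(a − b)² + 8d² + 12(a + b)d.
doubled-split-bound : ∀ a b d →
  let M = 3 * a + 3 * b + d; S = a + 3 * b + d; U = b + 3 * a + d in
  19 * (M * M) ≤ 9 * (M * M + (S * S + (2 * a) * (2 * a)) + (U * U + (2 * b) * (2 * b)))
doubled-split-bound a b d = +-cancelʳ-≤ (36 * (a * a + b * b)) _ _ (begin
  19 * (M * M) + 36 * (a * a + b * b)
    ≤⟨ m≤m+n _ gap ⟩
  19 * (M * M) + 36 * (a * a + b * b) + gap
    ≡⟨ expand a b d ⟩
  W + 36 * (2 * a * b)
    ≤⟨ +-monoʳ-≤ W (*-monoʳ-≤ 36 (2*m*n≤m²+n² a b)) ⟩
  W + 36 * (a * a + b * b) ∎)
  where
  open ≤-Reasoning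
  M S U W gap : ℕ
  M = 3 * a + 3 * b + d
  S = a + 3 * b + d
  U = b + 3 * a + d
  W = 9 * (M * M + (S * S + (2 * a) * (2 * a)) + (U * U + (2 * b) * (2 * b)))
  gap = 8 * (d * d) + 12 * (a * d) + 12 * (b * d)
  expand : ∀ a b d →
    19 * ((3 * a + 3 * b + d) * (3 * a + 3 * b + d)) + 36 * (a * a + b * b)
      + (8 * (d * d) + 12 * (a * d) + 12 * (b * d)) ≡
    9 * ((3 * a + 3 * b + d) * (3 * a + 3 * b + d)
         + ((a + 3 * b + d) * (a + 3 * b + d) + (2 * a) * (2 * a))
         + ((b + 3 * a + d) * (b + 3 * a + d) + (2 * b) * (2 * b)))
      + 36 * (2 * a * b)
  expand = solve-∀

double-complement : ∀ {m} s a b d → s + a ≡ m → 3 * (a + b) + d ≡ 2 * m → 2 * s ≡ a + 3 * b + d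
double-complement {m} s a b d s+a≡m 3[a+b]+d≡2m = +-cancelʳ-≡ (2 * a) (2 * s) _ (begin
  2 * s + 2 * a     ≡⟨ *-distribˡ-+ 2 s a ⟨
  2 * (s + a)       ≡⟨ cong (2 *_) s+a≡m ⟩
  2 * m             ≡⟨ 3[a+b]+d≡2m ⟨
  3 * (a + b) + d   ≡⟨ solve (a ∷ b ∷ d ∷ []) ⟩
  a + 3 * b + d + 2 * a ∎)
  where open ≡-Reasoning

split-bound : ∀ {m} s a t b → s + a ≡ m → t + b ≡ m → 3 * (a + b) ≤ 2 * m →
  19 * (m * m) ≤ 9 * (m * m + (s * s + a * a) + (t * t + b * b))
split-bound {m} s a t b s+a≡m t+b≡m 3[a+b]≤2m
  with d , 3[a+b]+d≡2m ← m≤n⇒∃[o]m+o≡n 3[a+b]≤2m =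
  *-cancelˡ-≤ 4 (subst₂ _≤_ (sym (quadruple-left 2m≡M)) (sym (quadruple-right 2m≡M 2s≡S 2t≡U))
                            (doubled-split-bound a b d))
  where
  2m≡M : 2 * m ≡ 3 * a + 3 * b + d
  2m≡M = trans (sym 3[a+b]+d≡2m) (cong (_+ d) (*-distribˡ-+ 3 a b))
  2s≡S : 2 * s ≡ a + 3 * b + d
  2s≡S = double-complement s a b d s+a≡m 3[a+b]+d≡2m
  2t≡U : 2 * t ≡ b + 3 * a + d
  2t≡U = double-complement t b a d t+b≡m (trans (cong (λ x → 3 * x + d) (+-comm b a)) 3[a+b]+d≡2m)

  quadruple-left : ∀ {M} → 2 * m ≡ M → 4 * (19 * (m * m)) ≡ 19 * (M * M)
  quadruple-left refl = solve (m ∷ [])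
  quadruple-right : ∀ {M S U} → 2 * m ≡ M → 2 * s ≡ S → 2 * t ≡ U →
    4 * (9 * (m * m + (s * s + a * a) + (t * t + b * b))) ≡
    9 * (M * M + (S * S + (2 * a) * (2 * a)) + (U * U + (2 * b) * (2 * b)))
  quadruple-right refl refl refl = solve (m ∷ s ∷ t ∷ a ∷ b ∷ [])

concentrated-two-heavy : ∀ {m u v w} → u + v + w ≡ m →
  Σ Matrix (Concentrated m (v3 (m + u) (m + v) w))
concentrated-two-heavy {m} {u} {v} {w} u+v+w≡m = _ , concentrated₃
  m 0 0
  0 m 0
  u v w
  (solve (m ∷ [])) (solve (m ∷ [])) u+v+w≡m
  (solve (m ∷ u ∷ [])) (solve (m ∷ v ∷ [])) refl
  (≤-trans (two-full-rows-bound u v w u+v+w≡m) (≤-reflexive (solve (m ∷ u ∷ v ∷ w ∷ []))))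

concentrated-very-heavy : ∀ {m u v w} → u + v + w ≡ m →
  Σ Matrix (Concentrated m (v3 (m + (m + u)) v w))
concentrated-very-heavy {m} {u} {v} {w} u+v+w≡m = _ , concentrated₃
  m 0 0
  m 0 0
  u v w
  (solve (m ∷ [])) (solve (m ∷ [])) u+v+w≡m
  (+-assoc m m u) refl refl
  (≤-trans (two-full-rows-bound u v w u+v+w≡m) (≤-reflexive (solve (m ∷ u ∷ v ∷ w ∷ []))))

concentrated-split-last : ∀ {m w b c} α β → b + α ≡ m → w + β ≡ m → α + β ≡ c → 3 * c ≤ 2 * m →
  Σ Matrix (Concentrated m (v3 (m + w) b c))
concentrated-split-last {m} {w} {b} {c} α β b+α≡m w+β≡m α+β≡c 3c≤2m = _ , concentrated₃
  m 0 0
  0 b α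
  w 0 β
  (solve (m ∷ [])) b+α≡m (trans (cong (_+ β) (+-identityʳ w)) w+β≡m)
  (cong (_+ w) (+-identityʳ m)) (+-identityʳ b) α+β≡c
  (≤-trans (split-bound b α w β b+α≡m w+β≡m (subst (λ x → 3 * x ≤ 2 * m) (sym α+β≡c) 3c≤2m))
           (≤-reflexive (solve (m ∷ b ∷ α ∷ w ∷ β ∷ []))))

concentrated-split-first : ∀ {m w b c} α β → b + α ≡ m → c + β ≡ m → α + β ≡ w → 3 * w ≤ 2 * m →
  Σ Matrix (Concentrated m (v3 (m + w) b c))
concentrated-split-first {m} {w} {b} {c} α β b+α≡m c+β≡m α+β≡w 3w≤2m = _ , concentrated₃
  m 0 0
  α b 0
  β 0 c
  (solve (m ∷ [])) (trans (+-identityʳ (α + b)) (trans (+-comm α b) b+α≡m))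
  (trans (cong (_+ c) (+-identityʳ β)) (trans (+-comm β c) c+β≡m))
  (trans (+-assoc m α β) (cong (m +_) α+β≡w)) (+-identityʳ b) refl
  (≤-trans (split-bound b α c β b+α≡m c+β≡m (subst (λ x → 3 * x ≤ 2 * m) (sym α+β≡w) 3w≤2m))
           (≤-reflexive (solve (m ∷ b ∷ α ∷ c ∷ β ∷ []))))

3*z≤x+y+z : ∀ {x y z} → z ≤ x → z ≤ y → 3 * z ≤ x + y + z
3*z≤x+y+z {x} {y} {z} z≤x z≤y = begin
  3 * z      ≡⟨ solve (z ∷ []) ⟩
  z + z + z  ≤⟨ +-monoˡ-≤ z (+-mono-≤ z≤x z≤y) ⟩
  x + y + z  ∎
  where open ≤-Reasoning

complements-sum : ∀ {m} x y z α β → x + y + z ≡ 2 * m → y + α ≡ m → x + β ≡ m → α + β ≡ z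
complements-sum {m} x y z α β x+y+z≡2m y+α≡m x+β≡m = +-cancelˡ-≡ (x + y) _ _ (begin
  x + y + (α + β)    ≡⟨ solve (x ∷ y ∷ α ∷ β ∷ []) ⟩
  (y + α) + (x + β)  ≡⟨ cong₂ _+_ y+α≡m x+β≡m ⟩
  m + m              ≡⟨ solve (m ∷ []) ⟩
  2 * m              ≡⟨ x+y+z≡2m ⟨
  x + y + z          ∎)
  where open ≡-Reasoning

x+y≡2m⇒m≤x : ∀ {m} x y → x + y ≡ 2 * m → y ≤ m → m ≤ x
x+y≡2m⇒m≤x {m} x y x+y≡2m y≤m = +-cancelʳ-≤ y m x (begin
  m + y  ≤⟨ +-monoʳ-≤ m y≤m ⟩
  m + m  ≡⟨ solve (m ∷ []) ⟩
  2 * m  ≡⟨ x+y≡2m ⟨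
  x + y  ∎)
  where open ≤-Reasoning

x+y≡2m⇒x≤m : ∀ {m} x y → x + y ≡ 2 * m → m ≤ y → x ≤ m
x+y≡2m⇒x≤m {m} x y x+y≡2m m≤y = +-cancelʳ-≤ y x m (begin
  x + y  ≡⟨ x+y≡2m ⟩
  2 * m  ≡⟨ solve (m ∷ []) ⟩
  m + m  ≤⟨ +-monoʳ-≤ m m≤y ⟩
  m + y  ∎)
  where open ≤-Reasoning

concentrated-split : ∀ {m} w b c → w ≤ m → b ≤ m → c ≤ b → w + b + c ≡ 2 * m →
  Σ Matrix (Concentrated m (v3 (m + w) b c))
concentrated-split {m} w b c w≤m b≤m c≤b w+b+c≡2m
  with β , w+β≡m ← m≤n⇒∃[o]m+o≡n w≤m
     | α , b+α≡m ← m≤n⇒∃[o]m+o≡n b≤m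
     | ≤-total c w
... | inj₁ c≤w =
  concentrated-split-last α β b+α≡m w+β≡m (complements-sum w b c α β w+b+c≡2m b+α≡m w+β≡m)
    (subst (3 * c ≤_) w+b+c≡2m (3*z≤x+y+z c≤w c≤b))
... | inj₂ w≤c with β′ , c+β′≡m ← m≤n⇒∃[o]m+o≡n (≤-trans c≤b b≤m) =
  concentrated-split-first α β′ b+α≡m c+β′≡m (complements-sum c b w α β′ c+b+w≡2m b+α≡m c+β′≡m)
    (subst (3 * w ≤_) c+b+w≡2m (3*z≤x+y+z w≤c (≤-trans w≤c c≤b)))
  where
  c+b+w≡2m : c + b + w ≡ 2 * m
  c+b+w≡2m = begin
    c + b + w  ≡⟨ solve (c ∷ b ∷ w ∷ []) ⟩
    w + b + c  ≡⟨ w+b+c≡2m ⟩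
    2 * m      ∎
    where open ≡-Reasoning

concentrated-one-heavy : ∀ {m} w b c → b ≤ m → c ≤ b → w + b + c ≡ 2 * m →
  Σ Matrix (Concentrated m (v3 (m + w) b c))
concentrated-one-heavy {m} w b c b≤m c≤b w+b+c≡2m
  with b + c ≤? m | trans (sym (+-assoc w b c)) w+b+c≡2m
... | yes b+c≤m | w+[b+c]≡2m
  with u , refl ← m≤n⇒∃[o]m+o≡n (x+y≡2m⇒m≤x w (b + c) w+[b+c]≡2m b+c≤m) =
  concentrated-very-heavy (+-cancelˡ-≡ m _ _ (begin
    m + (u + b + c)  ≡⟨ solve (m ∷ u ∷ b ∷ c ∷ []) ⟩
    m + u + b + c    ≡⟨ w+b+c≡2m ⟩
    2 * m            ≡⟨ solve (m ∷ []) ⟩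
    m + m            ∎))
  where open ≡-Reasoning
... | no b+c≰m | w+[b+c]≡2m =
  concentrated-split w b c (x+y≡2m⇒x≤m w (b + c) w+[b+c]≡2m (<⇒≤ (≰⇒> b+c≰m)))
    b≤m c≤b w+b+c≡2m

m≤max : ∀ {m a b c} → b ≤ a → c ≤ a → a + b + c ≡ 3 * m → m ≤ a
m≤max {m} {a} {b} {c} b≤a c≤a a+b+c≡3m = *-cancelˡ-≤ 3 (begin
  3 * m      ≡⟨ a+b+c≡3m ⟨
  a + b + c  ≤⟨ +-mono-≤ (+-monoʳ-≤ a b≤a) c≤a ⟩
  a + a + a  ≡⟨ solve (a ∷ []) ⟩
  3 * a      ∎)
  where open ≤-Reasoning

concentrated-sorted : ∀ {m} a b c → b ≤ a → c ≤ b → a + b + c ≡ 3 * m →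
  Σ Matrix (Concentrated m (v3 a b c))
concentrated-sorted {m} a b c b≤a c≤b a+b+c≡3m with m ≤? b
... | yes m≤b
  with v , refl ← m≤n⇒∃[o]m+o≡n m≤b
     | u , refl ← m≤n⇒∃[o]m+o≡n (≤-trans m≤b b≤a) =
  concentrated-two-heavy (+-cancelˡ-≡ (2 * m) _ _ (begin
    2 * m + (u + v + c)  ≡⟨ solve (m ∷ u ∷ v ∷ c ∷ []) ⟩
    m + u + (m + v) + c  ≡⟨ a+b+c≡3m ⟩
    3 * m                ≡⟨ solve (m ∷ []) ⟩
    2 * m + m            ∎))
  where open ≡-Reasoning
... | no m≰b
  with w , refl ← m≤n⇒∃[o]m+o≡n (m≤max {m} b≤a (≤-trans c≤b b≤a) a+b+c≡3m) =
  concentrated-one-heavy w b c (≰⇒≥ m≰b) c≤b (+-cancelˡ-≡ m _ _ (begin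
    m + (w + b + c)  ≡⟨ solve (m ∷ w ∷ b ∷ c ∷ []) ⟩
    m + w + b + c    ≡⟨ a+b+c≡3m ⟩
    3 * m            ≡⟨ solve (m ∷ []) ⟩
    m + 2 * m        ∎))
  where open ≡-Reasoning

concentrated-exists : ∀ m (N : Fin 3 → ℕ) → sum N ≡ 3 * m → Σ Matrix (Concentrated m N)
concentrated-exists m N ∑N≡3m with sort₃ N
... | π , 1≤0 , 2≤1 =
  let y , y-concentrated = concentrated-sorted (N′ 0F) (N′ 1F) (N′ 2F) 1≤0 2≤1 ∑N′≡3m
  in _ , concentrated-unpermute π (λ { 0F → refl ; 1F → refl ; 2F → refl }) y-concentrated
  where
  N′ : Fin 3 → ℕ
  N′ γ = N (π ⟨$⟩ʳ γ)
  ∑N′≡3m : N′ 0F + N′ 1F + N′ 2F ≡ 3 * m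
  ∑N′≡3m = trans (sym (∑₃ N′)) (trans (sym (∑-permute N π)) ∑N≡3m)

count-part≡ : ∀ {n m} (κ : Fin n → Fin 3) (σ : Fin n → Fin 3) {y : Matrix} →
  (∀ k γ → profile κ σ k γ ≡ y k γ) → (∀ k → ∑[ γ < 3 ] y k γ ≡ m) →
  ∀ k → count (part σ k) ≡ m
count-part≡ κ σ σ-profile row-sum k =
  trans (count≡∑classSize κ (part σ k)) (trans (sum-cong-≗ (σ-profile k)) (row-sum k))

edges-of-parts : ∀ {n m} {y : Matrix} (G : Graph n) (κ : Fin n → Fin 3) → IsProperColouring G κ →
  (σ : Fin n → Fin 3) → (∀ k γ → profile κ σ k γ ≡ y k γ) → (∀ k → ∑[ γ < 3 ] y k γ ≡ m) →
  2 * (e G (part σ 0F) + e G (part σ 1F) + e G (part σ 2F)) + squares y ≤ 3 * (m * m)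
edges-of-parts {m = m} {y} G κ proper σ σ-profile row-sum = begin
  2 * (E 0F + E 1F + E 2F) + squares y
    ≡⟨ cong (λ x → 2 * x + squares y) (∑₃ E) ⟨
  2 * sum E + squares y
    ≡⟨ cong (_+ squares y) (*-distribˡ-sum 2 E) ⟩
  ∑[ k < 3 ] (2 * E k) + squares y
    ≡⟨ ∑-distrib-+ (λ k → 2 * E k) (λ k → ∑[ γ < 3 ] (y k γ * y k γ)) ⟨
  ∑[ k < 3 ] (2 * E k + ∑[ γ < 3 ] (y k γ * y k γ))
    ≤⟨ ∑-mono-≤ part-bound ⟩
  3 * (m * m) ∎
  where
  open ≤-Reasoning
  E : Fin 3 → ℕ
  E k = e G (part σ k)

  part-bound : ∀ k → 2 * E k + ∑[ γ < 3 ] (y k γ * y k γ) ≤ m * m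
  part-bound k = subst₂ (λ q c → 2 * E k + q ≤ c * c)
    (sum-cong-≗ (λ γ → cong₂ _*_ (σ-profile k γ) (σ-profile k γ)))
    (count-part≡ κ σ σ-profile row-sum k)
    (edges-within G κ proper (part σ k))

81*E≤4*[3m]² : ∀ m E Q → 2 * E + Q ≤ 3 * (m * m) → 19 * (m * m) ≤ 9 * Q →
  81 * E ≤ 4 * ((3 * m) * (3 * m))
81*E≤4*[3m]² m E Q 2E+Q≤3m² 19m²≤9Q = *-cancelˡ-≤ 2 (begin
  2 * (81 * E)                 ≡⟨ solve (E ∷ []) ⟩
  9 * (18 * E)                 ≤⟨ *-monoʳ-≤ 9 18E≤8m² ⟩
  9 * (8 * (m * m))            ≡⟨ solve (m ∷ []) ⟩
  2 * (4 * ((3 * m) * (3 * m))) ∎)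
  where
  open ≤-Reasoning
  18E≤8m² : 18 * E ≤ 8 * (m * m)
  18E≤8m² = +-cancelʳ-≤ (19 * (m * m)) _ _ (begin
    18 * E + 19 * (m * m)       ≤⟨ +-monoʳ-≤ (18 * E) 19m²≤9Q ⟩
    18 * E + 9 * Q              ≡⟨ solve (E ∷ Q ∷ []) ⟩
    9 * (2 * E + Q)             ≤⟨ *-monoʳ-≤ 9 2E+Q≤3m² ⟩
    9 * (3 * (m * m))           ≡⟨ solve (m ∷ []) ⟩
    8 * (m * m) + 19 * (m * m)  ∎)

proposition2p9 : (m : ℕ) → (G : Graph (3 * m)) → Is3Partite G →
    Σ (Fin (3 * m) → Fin 3) (λ c →
      (card (part c zero) ≡ m × card (part c (suc zero)) ≡ m
        × card (part c (suc (suc zero))) ≡ m)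
      × 81 * (e G (part c zero) + e G (part c (suc zero))
              + e G (part c (suc (suc zero))))
        ≤ 4 * ((3 * m) * (3 * m)))
proposition2p9 m G (κ , proper) =
  σ , (card≡m 0F , card≡m 1F , card≡m 2F) ,
  81*E≤4*[3m]² m (e G (part σ 0F) + e G (part σ 1F) + e G (part σ 2F)) (squares y)
    (edges-of-parts G κ proper σ σ-profile row-sum) squares-bound
  where
  N : Fin 3 → ℕ
  N = classSize κ (λ _ → true)

  concentrated : Σ Matrix (Concentrated m N)
  concentrated = concentrated-exists m N (∑classSize≡n κ)

  y : Matrix
  y = proj₁ concentrated

  open Concentrated (proj₂ concentrated)

  realised : ∃[ σ ] (∀ k γ → profile κ σ k γ ≡ y k γ)
  realised = profile-realisable κ y col-sum

  σ : Fin (3 * m) → Fin 3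
  σ = proj₁ realised

  σ-profile : ∀ k γ → profile κ σ k γ ≡ y k γ
  σ-profile = proj₂ realised

  card≡m : ∀ k → card (part σ k) ≡ m
  card≡m k = trans (card≡count (part σ k)) (count-part≡ κ σ σ-profile row-sum k)
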